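{- Let $m,d\geq 1$ and let $f(x)\in\mathbb{Z}[x]$. (1) If $x^m-1$ divides $M_d(x)$, then $x^m-1$ divides $\sum_{e\mid d}\mu(e)f(x^{d/e})$. (2) If $x^m+1$ divides $M_d(x)$ and $f(x)$ is an odd polynomial, then $x^m+1$ divides $\sum_{e\mid d}\mu(e)f(x^{d/e})$.
   Context: $M_d(x)=\frac1d\sum_{e\mid d}\mu(e)x^{d/e}\in\mathbb{Q}[x]$ is the $d$th necklace polynomial, $\mu$ the Möbius function. Divisibility is in $\mathbb{Q}[x]$. A polynomial is odd if it has only odd-degree monomials. -}

module Defs where

open import Data.Nat using (ℕ; zero; suc; _/_) renaming (_+_ to _+ℕ_; _*_ to _*ℕ_)
open import Data.Nat.Divisibility using (_∣?_)
open import Data.Nat.Primality using (prime?)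
open import Data.Integer using (ℤ; +_; -_) renaming (_*_ to _*ℤ_)
open import Data.Rational using (ℚ; 0ℚ; 1ℚ) renaming (_+_ to _+ℚ_; _*_ to _*ℚ_; -_ to -ℚ_)
import Data.Rational as ℚ
open import Data.List using (List; []; _∷_; map; foldr; filter; upTo; length; replicate; _++_)
open import Relation.Nullary.Decidable using (_×-dec_)
open import Relation.Binary.PropositionalEquality using (_≡_)
open import Data.Product using (Σ)

-- Polynomials as coefficient lists, lowest degree first.
-- Trailing zeros are allowed; equality is coefficientwise (see _≈P_).
Poly : Set
Poly = List ℚ

PolyZ : Set
PolyZ = List ℤ

coeff : {A : Set} → A → List A → ℕ → A
coeff z []       _       = z
coeff z (a ∷ p)  zero    = a
coeff z (a ∷ p)  (suc n) = coeff z p n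

coeffQ : Poly → ℕ → ℚ
coeffQ = coeff 0ℚ

coeffZ : PolyZ → ℕ → ℤ
coeffZ = coeff (+ 0)

_≈P_ : Poly → Poly → Set
p ≈P q = ∀ n → coeffQ p n ≡ coeffQ q n

infixl 6 _+P_ _-P_
infixl 7 _*P_ _·P_

_+P_ : Poly → Poly → Poly
[]      +P q       = q
p       +P []      = p
(a ∷ p) +P (b ∷ q) = (a +ℚ b) ∷ (p +P q)

_·P_ : ℚ → Poly → Poly
c ·P p = map (c *ℚ_) p

negP : Poly → Poly
negP p = map -ℚ_ p

_-P_ : Poly → Poly → Poly
p -P q = p +P negP q

_*P_ : Poly → Poly → Poly
[]      *P q = []
(a ∷ p) *P q = (a ·P q) +P (0ℚ ∷ (p *P q))

oneP : Poly
oneP = 1ℚ ∷ []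

xpow : ℕ → Poly
xpow n = replicate n 0ℚ ++ (1ℚ ∷ [])

_∣P_ : Poly → Poly → Set
g ∣P p = Σ Poly (λ q → p ≈P (g *P q))

toQ : PolyZ → Poly
toQ = map (λ z → z ℚ./ 1)

compPow : Poly → ℕ → Poly
compPow []      k = []
compPow (a ∷ p) k = (a ∷ []) +P (xpow k *P compPow p k)

OddPoly : PolyZ → Set
OddPoly f = ∀ n → coeffZ f (2 *ℕ n) ≡ + 0

signPow : ℕ → ℤ
signPow zero    = + 1
signPow (suc k) = - signPow k

-- Möbius function: μ(n) = 0 if n is divisible by some square k^2 with k ≥ 2,
-- otherwise (-1)^(number of primes dividing n).  (Only used for n ≥ 1.)
μ : ℕ → ℤ
μ n with length (filter (λ k → ((2 +ℕ k) *ℕ (2 +ℕ k)) ∣? n) (upTo n))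
... | suc _ = + 0
... | zero  = signPow (length (filter (λ p → prime? p ×-dec (p ∣? n)) (upTo (suc n))))

-- Σ_{e ∣ d} F e (d/e), e ranging over the positive divisors of d
divisorSum : (d : ℕ) → (ℕ → ℕ → Poly) → Poly
divisorSum d F =
  foldr _+P_ [] (map (λ i → F (suc i) (d / suc i)) (filter (λ i → suc i ∣? d) (upTo d)))

-- necklace polynomial M_d(x) = (1/d) Σ_{e∣d} μ(e) x^{d/e}   (d ≥ 1; junk value 0 at d = 0)
necklace : ℕ → Poly
necklace zero    = []
necklace (suc k) =
  ((+ 1) ℚ./ (suc k)) ·P divisorSum (suc k) (λ e q → (μ e ℚ./ 1) ·P xpow q)

mobiusSum : ℕ → PolyZ → Poly
mobiusSum d f = divisorSum d (λ e q → (μ e ℚ./ 1) ·P compPow (toQ f) q)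

-- Both parts are instances of one statement about g = x^m - c, c ∈ ℚ.  Write
-- N(x) = Σ_i α_i x^{β_i} and f = Σ_k f_k x^k; then Σ_i α_i f(x^{β_i}) = Σ_k f_k N(x^k).
-- If c^k = c then x^{km} ≡ c^k = c mod g, so the substitution x ↦ x^k is well
-- defined on ℚ[x]/(g); hence g ∣ N implies g ∣ N(x^k).  So g divides the sum as
-- soon as f_k = 0 for every k with c^k ≠ c: for c = 1 there is no such k, and for
-- c = -1 these are the even k, where an odd f has no coefficients.
--
-- The quotient ℚ[x]/(g) is modelled concretely: a residue is a coordinate vector
-- V = ℕ → ℚ in the basis 1, x, …, x^(m-1) (coordinates ≥ m are ignored), x acts by
-- a twisted shift S, and red p = Σ_k p_k x^k is the residue of p.  The file first
-- develops linear combinations of vectors and the remainder polynomial of a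
-- vector, then (module Quotient) the criterion g ∣ p ⇔ red p = 0, the substitution
-- map Φ_k and the general statement substitution-divides; the theorem follows by
-- instantiating it with the divisor sum of M_d and c = ±1.
module Submission where

open import Defs
open import Data.Nat using (ℕ; zero; suc; _≤_; _<_; z≤n; s≤s; _∸_) renaming (_+_ to _+ℕ_; _*_ to _*ℕ_)
import Data.Nat as ℕ
import Data.Nat.Properties as ℕP
open import Data.Product using (_×_; _,_; Σ; proj₁; proj₂)
open import Data.Sum using (_⊎_; inj₁; inj₂; map₁; map₂)
open import Data.Integer using (+_)
open import Data.Rational using (ℚ; 0ℚ; 1ℚ) renaming (_+_ to _+ℚ_; _*_ to _*ℚ_; -_ to -ℚ_)
import Data.Rational as ℚ
import Data.Rational.Properties as ℚP
open import Data.Rational.Solver using (module +-*-Solver)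
open +-*-Solver
open import Data.Nat.Divisibility using (_∣?_)
open import Data.List using (List; []; _∷_; _++_; replicate; map; foldr; filter; upTo)
open import Relation.Binary.PropositionalEquality hiding (_≗_)
open ≡-Reasoning

coeff-+ : ∀ p q n → coeffQ (p +P q) n ≡ coeffQ p n +ℚ coeffQ q n
coeff-+ []      q       n       = sym (ℚP.+-identityˡ _)
coeff-+ (a ∷ p) []      n       = sym (ℚP.+-identityʳ _)
coeff-+ (a ∷ p) (b ∷ q) zero    = refl
coeff-+ (a ∷ p) (b ∷ q) (suc n) = coeff-+ p q n

coeff-· : ∀ a p n → coeffQ (a ·P p) n ≡ a *ℚ coeffQ p n
coeff-· a []      n       = sym (ℚP.*-zeroʳ a)
coeff-· a (b ∷ p) zero    = refl
coeff-· a (b ∷ p) (suc n) = coeff-· a p n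

∷-≈P : ∀ a {p q} → p ≈P q → (a ∷ p) ≈P (a ∷ q)
∷-≈P a p≈q zero    = refl
∷-≈P a p≈q (suc n) = p≈q n

-- Adding the zero polynomial on the right is the identity (needed because
-- xpow k is not syntactically a cons cell).
+P-[] : ∀ p → p +P [] ≡ p
+P-[] []      = refl
+P-[] (a ∷ p) = refl

shift : ℕ → Poly → Poly
shift k Q = replicate k 0ℚ ++ Q

coeff-shift-[] : ∀ k n → coeffQ (shift k []) n ≡ 0ℚ
coeff-shift-[] zero    n       = refl
coeff-shift-[] (suc k) zero    = refl
coeff-shift-[] (suc k) (suc n) = coeff-shift-[] k n

xpow-*P : ∀ k Q → (xpow k *P Q) ≈P shift k Q
xpow-*P zero Q n = begin
  coeffQ ((1ℚ ·P Q) +P (0ℚ ∷ [])) n         ≡⟨ coeff-+ (1ℚ ·P Q) (0ℚ ∷ []) n ⟩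
  coeffQ (1ℚ ·P Q) n +ℚ coeffQ (0ℚ ∷ []) n  ≡⟨ cong₂ _+ℚ_ (coeff-· 1ℚ Q n) (coeff-shift-[] 1 n) ⟩
  1ℚ *ℚ coeffQ Q n +ℚ 0ℚ                    ≡⟨ solve 1 (λ x → con 1ℚ :* x :+ con 0ℚ := x) refl (coeffQ Q n) ⟩
  coeffQ Q n                                ∎
xpow-*P (suc k) Q n = begin
  coeffQ ((0ℚ ·P Q) +P (0ℚ ∷ (xpow k *P Q))) n          ≡⟨ coeff-+ (0ℚ ·P Q) (0ℚ ∷ (xpow k *P Q)) n ⟩
  coeffQ (0ℚ ·P Q) n +ℚ coeffQ (0ℚ ∷ (xpow k *P Q)) n   ≡⟨ cong₂ _+ℚ_ (coeff-· 0ℚ Q n) (∷-≈P 0ℚ (xpow-*P k Q) n) ⟩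
  0ℚ *ℚ coeffQ Q n +ℚ coeffQ (shift (suc k) Q) n        ≡⟨ solve 2 (λ x y → con 0ℚ :* x :+ y := y) refl (coeffQ Q n) (coeffQ (shift (suc k) Q) n) ⟩
  coeffQ (shift (suc k) Q) n                            ∎

ΣP : {A : Set} → List A → (A → Poly) → Poly
ΣP xs G = foldr _+P_ [] (map G xs)

V : Set
V = ℕ → ℚ

infix 4 _≗_
_≗_ : V → V → Set
v ≗ w = ∀ r → v r ≡ w r

0V : V
0V _ = 0ℚ

e0 : V
e0 zero    = 1ℚ
e0 (suc _) = 0ℚ

infixl 6 _+V_
infixl 7 _·V_

_+V_ : V → V → V
(v +V w) r = v r +ℚ w r

_·V_ : ℚ → V → V
(a ·V v) r = a *ℚ v r

record IsLinear (L : V → V) : Set where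
  field
    L-+ : ∀ v w → L (v +V w) ≗ L v +V L w
    L-· : ∀ a v → L (a ·V v) ≗ a ·V L v
    L-0 : L 0V ≗ 0V
open IsLinear

scale-linear : ∀ a → IsLinear (a ·V_)
scale-linear a = record
  { L-+ = λ v w r → ℚP.*-distribˡ-+ a (v r) (w r)
  ; L-· = λ b v r → solve 3 (λ a b x → a :* (b :* x) := b :* (a :* x)) refl a b (v r)
  ; L-0 = λ r → ℚP.*-zeroʳ a
  }

lincomb : Poly → (ℕ → V) → V
lincomb []      F = 0V
lincomb (a ∷ p) F = a ·V F 0 +V lincomb p (λ k → F (suc k))

lincomb-cong : ∀ p F G r → (∀ k → F k r ≡ G k r) → lincomb p F r ≡ lincomb p G r
lincomb-cong []      F G r F≡G = refl
lincomb-cong (a ∷ p) F G r F≡G =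
  cong₂ _+ℚ_ (cong (a *ℚ_) (F≡G 0)) (lincomb-cong p (λ k → F (suc k)) (λ k → G (suc k)) r (λ k → F≡G (suc k)))

lincomb-vanish : ∀ p F r → (∀ k → coeffQ p k ≡ 0ℚ ⊎ F k r ≡ 0ℚ) → lincomb p F r ≡ 0ℚ
lincomb-vanish []      F r h = refl
lincomb-vanish (a ∷ p) F r h = begin
  a *ℚ F 0 r +ℚ lincomb p (λ k → F (suc k)) r ≡⟨ cong₂ _+ℚ_ (summand (h 0)) (lincomb-vanish p _ r (λ k → h (suc k))) ⟩
  0ℚ +ℚ 0ℚ                                   ≡⟨ ℚP.+-identityʳ 0ℚ ⟩
  0ℚ                                         ∎
  where
  summand : a ≡ 0ℚ ⊎ F 0 r ≡ 0ℚ → a *ℚ F 0 r ≡ 0ℚ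
  summand (inj₁ a≡0) = trans (cong (_*ℚ F 0 r) a≡0) (ℚP.*-zeroˡ (F 0 r))
  summand (inj₂ F≡0) = trans (cong (a *ℚ_) F≡0) (ℚP.*-zeroʳ a)

lincomb-≈P : ∀ p q F → p ≈P q → lincomb p F ≗ lincomb q F
lincomb-≈P []      q       F p≈q r = sym (lincomb-vanish q F r (λ k → inj₁ (sym (p≈q k))))
lincomb-≈P (a ∷ p) []      F p≈q r = lincomb-vanish (a ∷ p) F r (λ k → inj₁ (p≈q k))
lincomb-≈P (a ∷ p) (b ∷ q) F p≈q r =
  cong₂ (λ x y → x *ℚ F 0 r +ℚ y) (p≈q 0) (lincomb-≈P p q _ (λ n → p≈q (suc n)) r)

lincomb-+P : ∀ p q F → lincomb (p +P q) F ≗ lincomb p F +V lincomb q F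
lincomb-+P []      q       F r = sym (ℚP.+-identityˡ _)
lincomb-+P (a ∷ p) []      F r = sym (ℚP.+-identityʳ _)
lincomb-+P (a ∷ p) (b ∷ q) F r =
  trans (cong ((a +ℚ b) *ℚ F 0 r +ℚ_) (lincomb-+P p q _ r))
        (solve 5 (λ a b f x y → (a :+ b) :* f :+ (x :+ y) := (a :* f :+ x) :+ (b :* f :+ y))
               refl a b (F 0 r) (lincomb p _ r) (lincomb q _ r))

lincomb-·P : ∀ a p F → lincomb (a ·P p) F ≗ a ·V lincomb p F
lincomb-·P a []      F r = sym (ℚP.*-zeroʳ a)
lincomb-·P a (b ∷ p) F r =
  trans (cong (a *ℚ b *ℚ F 0 r +ℚ_) (lincomb-·P a p _ r))
        (solve 4 (λ a b f x → a :* b :* f :+ a :* x := a :* (b :* f :+ x)) refl a b (F 0 r) (lincomb p _ r))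

lincomb-+V : ∀ p F G → lincomb p (λ k → F k +V G k) ≗ lincomb p F +V lincomb p G
lincomb-+V []      F G r = sym (ℚP.+-identityʳ 0ℚ)
lincomb-+V (a ∷ p) F G r =
  trans (cong (a *ℚ (F 0 r +ℚ G 0 r) +ℚ_) (lincomb-+V p _ _ r))
        (solve 5 (λ a f g x y → a :* (f :+ g) :+ (x :+ y) := (a :* f :+ x) :+ (a :* g :+ y))
               refl a (F 0 r) (G 0 r) (lincomb p _ r) (lincomb p _ r))

lincomb-linear : ∀ {L} → IsLinear L → ∀ p F → L (lincomb p F) ≗ lincomb p (λ k → L (F k))
lincomb-linear lin []      F r = L-0 lin r
lincomb-linear lin (a ∷ p) F r =
  trans (L-+ lin _ _ r) (cong₂ _+ℚ_ (L-· lin a (F 0) r) (lincomb-linear lin p _ r))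

sumV : {A : Set} → List A → (A → V) → V
sumV []       F = 0V
sumV (i ∷ is) F = F i +V sumV is F

sumV-cong : ∀ {A : Set} (xs : List A) {F G} r → (∀ i → F i r ≡ G i r) → sumV xs F r ≡ sumV xs G r
sumV-cong []       r F≡G = refl
sumV-cong (i ∷ is) r F≡G = cong₂ _+ℚ_ (F≡G i) (sumV-cong is r F≡G)

sumV-linear : ∀ {L} → IsLinear L → ∀ {A : Set} (xs : List A) (α : A → ℚ) (X : A → V) →
              L (sumV xs (λ i → α i ·V X i)) ≗ sumV xs (λ i → α i ·V L (X i))
sumV-linear lin []       α X r = L-0 lin r
sumV-linear lin (i ∷ is) α X r =
  trans (L-+ lin _ _ r) (cong₂ _+ℚ_ (L-· lin (α i) (X i) r) (sumV-linear lin is α X r))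

sumV-lincomb : ∀ {A : Set} (xs : List A) p (G : A → ℕ → V) →
               sumV xs (λ i → lincomb p (G i)) ≗ lincomb p (λ k → sumV xs (λ i → G i k))
sumV-lincomb []       p G r = sym (lincomb-vanish p _ r (λ k → inj₂ refl))
sumV-lincomb (i ∷ is) p G r =
  trans (cong (lincomb p (G i) r +ℚ_) (sumV-lincomb is p G r)) (sym (lincomb-+V p (G i) _ r))

lincomb-ΣP : ∀ {A : Set} (xs : List A) (α : A → ℚ) (G : A → Poly) F →
             lincomb (ΣP xs (λ i → α i ·P G i)) F ≗ sumV xs (λ i → α i ·V lincomb (G i) F)
lincomb-ΣP []       α G F r = refl
lincomb-ΣP (i ∷ is) α G F r =
  trans (lincomb-+P (α i ·P G i) _ F r)
        (cong₂ _+ℚ_ (lincomb-·P (α i) (G i) F r) (lincomb-ΣP is α G F r))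

rem : ℕ → V → Poly
rem zero    v = []
rem (suc k) v = v 0 ∷ rem k (λ r → v (suc r))

rem-cong : ∀ k {v w} → (∀ r → r < k → v r ≡ w r) → rem k v ≡ rem k w
rem-cong zero    v≡w = refl
rem-cong (suc k) v≡w = cong₂ _∷_ (v≡w 0 (s≤s z≤n)) (rem-cong k (λ r r<k → v≡w (suc r) (s≤s r<k)))

coeff-rem-0V : ∀ k n → coeffQ (rem k 0V) n ≡ 0ℚ
coeff-rem-0V zero    n       = refl
coeff-rem-0V (suc k) zero    = refl
coeff-rem-0V (suc k) (suc n) = coeff-rem-0V k n

rem-+ : ∀ k v w → rem k (v +V w) ≡ rem k v +P rem k w
rem-+ zero    v w = refl
rem-+ (suc k) v w = cong (v 0 +ℚ w 0 ∷_) (rem-+ k _ _)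

rem-· : ∀ k a v → rem k (a ·V v) ≡ a ·P rem k v
rem-· zero    a v = refl
rem-· (suc k) a v = cong (a *ℚ v 0 ∷_) (rem-· k a _)

lincomb-rem-suc : ∀ k v F → lincomb (rem (suc k) v) F ≗ lincomb (rem k v) F +V v k ·V F k
lincomb-rem-suc zero    v F r = solve 1 (λ x → x :+ con 0ℚ := con 0ℚ :+ x) refl (v 0 *ℚ F 0 r)
lincomb-rem-suc (suc k) v F r =
  trans (cong (v 0 *ℚ F 0 r +ℚ_) (lincomb-rem-suc k _ _ r))
        (sym (ℚP.+-assoc (v 0 *ℚ F 0 r) _ _))

coeff-rem-++ : ∀ k v Q n → coeffQ (rem k v ++ Q) n ≡ coeffQ (rem k v) n +ℚ coeffQ (shift k Q) n
coeff-rem-++ zero    v Q n       = sym (ℚP.+-identityˡ _)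
coeff-rem-++ (suc k) v Q zero    = sym (ℚP.+-identityʳ (v 0))
coeff-rem-++ (suc k) v Q (suc n) = coeff-rem-++ k _ Q n

rem-snoc : ∀ k v Q → rem k v ++ (v k ∷ Q) ≡ rem (suc k) v ++ Q
rem-snoc zero    v Q = refl
rem-snoc (suc k) v Q = cong (v 0 ∷_) (rem-snoc k _ Q)

-- The top coefficient of a remainder can be moved into the shifted part:
-- both sides are coefficients of v_0 + … + v_k x^k + x^(k+1) Q.
rem-shift-exchange : ∀ k v Q n →
  coeffQ (rem (suc k) v) n +ℚ coeffQ (shift (suc k) Q) n ≡ coeffQ (rem k v) n +ℚ coeffQ (shift k (v k ∷ Q)) n
rem-shift-exchange k v Q n = begin
  coeffQ (rem (suc k) v) n +ℚ coeffQ (shift (suc k) Q) n ≡⟨ sym (coeff-rem-++ (suc k) v Q n) ⟩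
  coeffQ (rem (suc k) v ++ Q) n                          ≡⟨ cong (λ P → coeffQ P n) (sym (rem-snoc k v Q)) ⟩
  coeffQ (rem k v ++ (v k ∷ Q)) n                        ≡⟨ coeff-rem-++ k v (v k ∷ Q) n ⟩
  coeffQ (rem k v) n +ℚ coeffQ (shift k (v k ∷ Q)) n     ∎

infixr 8 _^_
_^_ : ℚ → ℕ → ℚ
c ^ zero  = 1ℚ
c ^ suc j = c *ℚ c ^ j

*-cancel-zero : ∀ a .{{_ : ℚ.NonZero a}} x → a *ℚ x ≡ 0ℚ → x ≡ 0ℚ
*-cancel-zero a x ax≡0 = begin
  x                       ≡⟨ sym (ℚP.*-identityˡ x) ⟩
  1ℚ *ℚ x                 ≡⟨ cong (_*ℚ x) (sym (ℚP.*-inverseˡ a)) ⟩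
  ℚ.1/ a *ℚ a *ℚ x        ≡⟨ ℚP.*-assoc (ℚ.1/ a) a x ⟩
  ℚ.1/ a *ℚ (a *ℚ x)      ≡⟨ cong (ℚ.1/ a *ℚ_) ax≡0 ⟩
  ℚ.1/ a *ℚ 0ℚ            ≡⟨ ℚP.*-zeroʳ (ℚ.1/ a) ⟩
  0ℚ                      ∎

-- The quotient ring ℚ[x]/(x^m - c), m = suc m'

module Quotient (m' : ℕ) (c : ℚ) where

  m : ℕ
  m = suc m'

  g : Poly
  g = xpow m +P ((-ℚ c) ∷ [])

  infix 4 _≈m_
  _≈m_ : V → V → Set
  v ≈m w = ∀ r → r < m → v r ≡ w r

  -- Multiplication by x: the coordinates move up and x · x^(m-1) = c.
  S : V → V
  S v zero    = c *ℚ v m'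
  S v (suc r) = v r

  S^ : ℕ → V → V
  S^ zero    v = v
  S^ (suc n) v = S (S^ n v)

  xres : ℕ → V
  xres n = S^ n e0

  S-cong : ∀ {v w} → v ≗ w → S v ≗ S w
  S-cong v≗w zero    = cong (c *ℚ_) (v≗w m')
  S-cong v≗w (suc r) = v≗w r

  S-congm : ∀ {v w} → v ≈m w → S v ≈m S w
  S-congm v≈w zero    _           = cong (c *ℚ_) (v≈w m' (ℕP.n<1+n m'))
  S-congm v≈w (suc r) (s≤s r<m')  = v≈w r (ℕP.m<n⇒m<1+n r<m')

  S^-cong : ∀ n {v w} → v ≗ w → S^ n v ≗ S^ n w
  S^-cong zero    v≗w = v≗w
  S^-cong (suc n) v≗w = S-cong (S^-cong n v≗w)

  S^-congm : ∀ n {v w} → v ≈m w → S^ n v ≈m S^ n w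
  S^-congm zero    v≈w = v≈w
  S^-congm (suc n) v≈w = S-congm (S^-congm n v≈w)

  S-linear : IsLinear S
  S-linear = record
    { L-+ = λ { v w zero → ℚP.*-distribˡ-+ c (v m') (w m') ; v w (suc r) → refl }
    ; L-· = λ { a v zero → solve 3 (λ c a x → c :* (a :* x) := a :* (c :* x)) refl c a (v m')
              ; a v (suc r) → refl }
    ; L-0 = λ { zero → ℚP.*-zeroʳ c ; (suc r) → refl }
    }

  S^-linear : ∀ n → IsLinear (S^ n)
  S^-linear zero    = record { L-+ = λ _ _ _ → refl ; L-· = λ _ _ _ → refl ; L-0 = λ _ → refl }
  S^-linear (suc n) = record
    { L-+ = λ v w r → trans (S-cong (L-+ (S^-linear n) v w) r) (L-+ S-linear _ _ r)
    ; L-· = λ a v r → trans (S-cong (L-· (S^-linear n) a v) r) (L-· S-linear a _ r)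
    ; L-0 = λ r → trans (S-cong (L-0 (S^-linear n)) r) (L-0 S-linear r)
    }

  S^-+ : ∀ a b v → S^ (a +ℕ b) v ≡ S^ a (S^ b v)
  S^-+ zero    b v = refl
  S^-+ (suc a) b v = cong S (S^-+ a b v)

  S^-shift : ∀ j u x → S^ j u (x +ℕ j) ≡ u x
  S^-shift zero    u x = cong u (ℕP.+-identityʳ x)
  S^-shift (suc j) u x = trans (cong (S (S^ j u)) (ℕP.+-suc x j)) (S^-shift j u x)

  -- x^m ≡ c: coordinate r < m passes once through the top, picking up c.
  S^-m : ∀ v → S^ m v ≈m c ·V v
  S^-m v r r<m = begin
    S^ m v r                      ≡⟨ cong (λ n → S^ n v r) m≡r+1+t ⟩
    S^ (r +ℕ suc t) v r           ≡⟨ cong (λ u → u r) (S^-+ r (suc t) v) ⟩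
    S^ r (S (S^ t v)) (0 +ℕ r)    ≡⟨ S^-shift r (S (S^ t v)) 0 ⟩
    c *ℚ S^ t v m'                ≡⟨ cong (λ i → c *ℚ S^ t v i) (sym r+t≡m') ⟩
    c *ℚ S^ t v (r +ℕ t)          ≡⟨ cong (c *ℚ_) (S^-shift t v r) ⟩
    c *ℚ v r                      ∎
    where
    t : ℕ
    t = m' ∸ r
    r+t≡m' : r +ℕ t ≡ m'
    r+t≡m' = ℕP.m+[n∸m]≡n (ℕP.≤-pred r<m)
    m≡r+1+t : m ≡ r +ℕ suc t
    m≡r+1+t = trans (cong suc (sym r+t≡m')) (sym (ℕP.+-suc r t))

  S^-power : ∀ j v → S^ (j *ℕ m) v ≈m (c ^ j) ·V v
  S^-power zero    v r _   = sym (ℚP.*-identityˡ (v r))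
  S^-power (suc j) v r r<m = begin
    S^ (m +ℕ j *ℕ m) v r     ≡⟨ cong (λ u → u r) (S^-+ m (j *ℕ m) v) ⟩
    S^ m (S^ (j *ℕ m) v) r   ≡⟨ S^-m (S^ (j *ℕ m) v) r r<m ⟩
    c *ℚ S^ (j *ℕ m) v r     ≡⟨ cong (c *ℚ_) (S^-power j v r r<m) ⟩
    c *ℚ (c ^ j *ℚ v r)      ≡⟨ sym (ℚP.*-assoc c (c ^ j) (v r)) ⟩
    c *ℚ c ^ j *ℚ v r        ∎

  red : Poly → V
  red p = lincomb p xres

  red-∷ : ∀ a p → red (a ∷ p) ≗ a ·V e0 +V S (red p)
  red-∷ a p r = cong (a *ℚ e0 r +ℚ_) (sym (lincomb-linear S-linear p xres r))

  red-const : ∀ a → red (a ∷ []) ≗ a ·V e0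
  red-const a r = ℚP.+-identityʳ (a *ℚ e0 r)

  red-shift : ∀ k Q → red (shift k Q) ≗ S^ k (red Q)
  red-shift zero    Q r = refl
  red-shift (suc k) Q r = begin
    red (0ℚ ∷ shift k Q) r                   ≡⟨ red-∷ 0ℚ (shift k Q) r ⟩
    0ℚ *ℚ e0 r +ℚ S (red (shift k Q)) r      ≡⟨ cong (0ℚ *ℚ e0 r +ℚ_) (S-cong (red-shift k Q) r) ⟩
    0ℚ *ℚ e0 r +ℚ S (S^ k (red Q)) r         ≡⟨ solve 2 (λ e y → con 0ℚ :* e :+ y := y) refl (e0 r) (S (S^ k (red Q)) r) ⟩
    S^ (suc k) (red Q) r                     ∎

  red-xpow : ∀ k → red (xpow k) ≗ xres k
  red-xpow k r = trans (red-shift k oneP r)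
                       (S^-cong k (λ r → trans (red-const 1ℚ r) (ℚP.*-identityˡ (e0 r))) r)

  red-xpow-*P : ∀ k Q → red (xpow k *P Q) ≗ S^ k (red Q)
  red-xpow-*P k Q r = trans (lincomb-≈P (xpow k *P Q) (shift k Q) xres (xpow-*P k Q) r) (red-shift k Q r)

  red-compPow : ∀ p q → red (compPow p q) ≗ lincomb p (λ k → xres (k *ℕ q))
  red-compPow []      q r = refl
  red-compPow (a ∷ p) q r = begin
    red ((a ∷ []) +P (xpow q *P compPow p q)) r
      ≡⟨ lincomb-+P (a ∷ []) (xpow q *P compPow p q) xres r ⟩
    red (a ∷ []) r +ℚ red (xpow q *P compPow p q) r
      ≡⟨ cong₂ _+ℚ_ (red-const a r) (red-xpow-*P q (compPow p q) r) ⟩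
    a *ℚ e0 r +ℚ S^ q (red (compPow p q)) r
      ≡⟨ cong (a *ℚ e0 r +ℚ_) (S^-cong q (red-compPow p q) r) ⟩
    a *ℚ e0 r +ℚ S^ q (lincomb p (λ k → xres (k *ℕ q))) r
      ≡⟨ cong (a *ℚ e0 r +ℚ_) (lincomb-linear (S^-linear q) p _ r) ⟩
    a *ℚ e0 r +ℚ lincomb p (λ k → S^ q (xres (k *ℕ q))) r
      ≡⟨ cong (a *ℚ e0 r +ℚ_) (lincomb-cong p (λ k → S^ q (xres (k *ℕ q))) (λ k → xres (suc k *ℕ q)) r (λ k → cong (λ u → u r) (sym (S^-+ q (k *ℕ q) e0)))) ⟩
    lincomb (a ∷ p) (λ k → xres (k *ℕ q)) r
      ∎

  -- Divisibility by g is the vanishing of the residue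

  coeff-g*P : ∀ Q n → coeffQ (g *P Q) n ≡ (-ℚ c) *ℚ coeffQ Q n +ℚ coeffQ (shift m Q) n
  coeff-g*P Q n = begin
    coeffQ (((0ℚ +ℚ -ℚ c) ·P Q) +P (0ℚ ∷ ((xpow m' +P []) *P Q))) n
      ≡⟨ coeff-+ ((0ℚ +ℚ -ℚ c) ·P Q) _ n ⟩
    coeffQ ((0ℚ +ℚ -ℚ c) ·P Q) n +ℚ coeffQ (0ℚ ∷ ((xpow m' +P []) *P Q)) n
      ≡⟨ cong₂ _+ℚ_ (trans (coeff-· (0ℚ +ℚ -ℚ c) Q n) (cong (_*ℚ coeffQ Q n) (ℚP.+-identityˡ (-ℚ c))))
                    (∷-≈P 0ℚ top n) ⟩
    (-ℚ c) *ℚ coeffQ Q n +ℚ coeffQ (shift m Q) n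
      ∎
    where
    top : ((xpow m' +P []) *P Q) ≈P shift m' Q
    top n = trans (cong (λ P → coeffQ (P *P Q) n) (+P-[] (xpow m'))) (xpow-*P m' Q n)

  red-g*P : ∀ Q → red (g *P Q) ≈m 0V
  red-g*P Q r r<m = begin
    red (g *P Q) r                              ≡⟨ lincomb-≈P (g *P Q) ((-ℚ c) ·P Q +P shift m Q) xres g*Q≈ r ⟩
    red ((-ℚ c) ·P Q +P shift m Q) r            ≡⟨ lincomb-+P ((-ℚ c) ·P Q) (shift m Q) xres r ⟩
    red ((-ℚ c) ·P Q) r +ℚ red (shift m Q) r    ≡⟨ cong₂ _+ℚ_ (lincomb-·P (-ℚ c) Q xres r) (red-shift m Q r) ⟩
    (-ℚ c) *ℚ red Q r +ℚ S^ m (red Q) r         ≡⟨ cong ((-ℚ c) *ℚ red Q r +ℚ_) (S^-m (red Q) r r<m) ⟩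
    (-ℚ c) *ℚ red Q r +ℚ c *ℚ red Q r           ≡⟨ solve 2 (λ c x → (:- c) :* x :+ c :* x := con 0ℚ) refl c (red Q r) ⟩
    0ℚ                                          ∎
    where
    g*Q≈ : (g *P Q) ≈P ((-ℚ c) ·P Q +P shift m Q)
    g*Q≈ n = trans (coeff-g*P Q n)
                   (sym (trans (coeff-+ ((-ℚ c) ·P Q) (shift m Q) n) (cong (_+ℚ coeffQ (shift m Q) n) (coeff-· (-ℚ c) Q n))))

  divides⇒red≈0 : ∀ p → g ∣P p → red p ≈m 0V
  divides⇒red≈0 p (Q , p≈gQ) r r<m = trans (lincomb-≈P p (g *P Q) xres p≈gQ r) (red-g*P Q r r<m)

  division : ∀ p → Σ Poly λ Q → ∀ n → coeffQ p n ≡ coeffQ (g *P Q) n +ℚ coeffQ (rem m (red p)) n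
  division [] = [] , λ n → sym (begin
    coeffQ (g *P []) n +ℚ coeffQ (rem m 0V) n         ≡⟨ cong₂ _+ℚ_ (coeff-g*P [] n) (coeff-rem-0V m n) ⟩
    (-ℚ c) *ℚ 0ℚ +ℚ coeffQ (shift m []) n +ℚ 0ℚ      ≡⟨ cong (λ z → (-ℚ c) *ℚ 0ℚ +ℚ z +ℚ 0ℚ) (coeff-shift-[] m n) ⟩
    (-ℚ c) *ℚ 0ℚ +ℚ 0ℚ +ℚ 0ℚ                         ≡⟨ solve 1 (λ x → x :* con 0ℚ :+ con 0ℚ :+ con 0ℚ := con 0ℚ) refl (-ℚ c) ⟩
    0ℚ                                                ∎)
  -- For a ∷ p = a + x p with p = g Q + ρ: x ρ has degree m, and trading its top
  -- coefficient v_{m-1} x^m for v_{m-1} g gives the quotient v_{m-1} + x Q.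
  division (a ∷ p) = (v m' ∷ Q) , step
    where
    Q : Poly
    Q = proj₁ (division p)
    v : V
    v = red p
    -- the residue of a ∷ p = a + x p is a + x v, whose coordinates above 0 are those of v
    rem-red : rem m (red (a ∷ p)) ≡ (a *ℚ 1ℚ +ℚ c *ℚ v m') ∷ rem m' v
    rem-red = trans (rem-cong m (λ r _ → red-∷ a p r))
                    (cong ((a *ℚ 1ℚ +ℚ c *ℚ v m') ∷_) (rem-cong m' (λ r _ → solve 2 (λ a x → a :* con 0ℚ :+ x := x) refl a (v r))))
    step : ∀ n → coeffQ (a ∷ p) n ≡ coeffQ (g *P (v m' ∷ Q)) n +ℚ coeffQ (rem m (red (a ∷ p))) n
    step zero = sym (begin
      coeffQ (g *P (v m' ∷ Q)) 0 +ℚ coeffQ (rem m (red (a ∷ p))) 0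
        ≡⟨ cong₂ _+ℚ_ (coeff-g*P (v m' ∷ Q) 0) (cong (λ P → coeffQ P 0) rem-red) ⟩
      (-ℚ c) *ℚ v m' +ℚ 0ℚ +ℚ (a *ℚ 1ℚ +ℚ c *ℚ v m')
        ≡⟨ solve 3 (λ c b a → (:- c) :* b :+ con 0ℚ :+ (a :* con 1ℚ :+ c :* b) := a) refl c (v m') a ⟩
      a ∎)
    step (suc n) = begin
      coeffQ p n
        ≡⟨ proj₂ (division p) n ⟩
      coeffQ (g *P Q) n +ℚ coeffQ (rem m v) n
        ≡⟨ cong (_+ℚ coeffQ (rem m v) n) (coeff-g*P Q n) ⟩
      cQn +ℚ coeffQ (shift m Q) n +ℚ coeffQ (rem m v) n
        ≡⟨ solve 3 (λ x y z → x :+ y :+ z := x :+ (z :+ y)) refl cQn (coeffQ (shift m Q) n) (coeffQ (rem m v) n) ⟩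
      cQn +ℚ (coeffQ (rem m v) n +ℚ coeffQ (shift m Q) n)
        ≡⟨ cong (cQn +ℚ_) (rem-shift-exchange m' v Q n) ⟩
      cQn +ℚ (coeffQ (rem m' v) n +ℚ coeffQ (shift m' (v m' ∷ Q)) n)
        ≡⟨ solve 3 (λ x y z → x :+ (y :+ z) := x :+ z :+ y) refl cQn (coeffQ (rem m' v) n) (coeffQ (shift m' (v m' ∷ Q)) n) ⟩
      cQn +ℚ coeffQ (shift m' (v m' ∷ Q)) n +ℚ coeffQ (rem m' v) n
        ≡⟨ cong₂ _+ℚ_ (sym (coeff-g*P (v m' ∷ Q) (suc n))) (cong (λ P → coeffQ P (suc n)) (sym rem-red)) ⟩
      coeffQ (g *P (v m' ∷ Q)) (suc n) +ℚ coeffQ (rem m (red (a ∷ p))) (suc n)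
        ∎
      where
      cQn : ℚ
      cQn = (-ℚ c) *ℚ coeffQ Q n

  red≈0⇒divides : ∀ p → red p ≈m 0V → g ∣P p
  red≈0⇒divides p red≈0 = Q , λ n → begin
    coeffQ p n                                      ≡⟨ proj₂ (division p) n ⟩
    coeffQ (g *P Q) n +ℚ coeffQ (rem m (red p)) n   ≡⟨ cong (λ P → coeffQ (g *P Q) n +ℚ coeffQ P n) (rem-cong m red≈0) ⟩
    coeffQ (g *P Q) n +ℚ coeffQ (rem m 0V) n        ≡⟨ cong (coeffQ (g *P Q) n +ℚ_) (coeff-rem-0V m n) ⟩
    coeffQ (g *P Q) n +ℚ 0ℚ                         ≡⟨ ℚP.+-identityʳ _ ⟩
    coeffQ (g *P Q) n                               ∎
    where
    Q : Poly
    Q = proj₁ (division p)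

  ∣P-cancel : ∀ a .{{_ : ℚ.NonZero a}} p → g ∣P (a ·P p) → g ∣P p
  ∣P-cancel a p g∣ap = red≈0⇒divides p λ r r<m →
    *-cancel-zero a (red p r) (trans (sym (lincomb-·P a p xres r)) (divides⇒red≈0 (a ·P p) g∣ap r r<m))

  -- The substitution x ↦ x^j on residues

  powers : ℕ → ℕ → V
  powers j r = xres (j *ℕ r)

  powers-suc : ∀ j r → S^ j (powers j r) ≡ powers j (suc r)
  powers-suc j r = trans (sym (S^-+ j (j *ℕ r) e0)) (cong xres (sym (ℕP.*-suc j r)))

  Φ : ℕ → V → V
  Φ j v = lincomb (rem m v) (powers j)

  Φ-linear : ∀ j → IsLinear (Φ j)
  Φ-linear j = record
    { L-+ = λ v w r → trans (cong (λ P → lincomb P (powers j) r) (rem-+ m v w))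
                            (lincomb-+P (rem m v) (rem m w) (powers j) r)
    ; L-· = λ a v r → trans (cong (λ P → lincomb P (powers j) r) (rem-· m a v))
                            (lincomb-·P a (rem m v) (powers j) r)
    ; L-0 = λ r → lincomb-vanish (rem m 0V) (powers j) r (λ k → inj₁ (coeff-rem-0V m k))
    }

  Φ-congm : ∀ j {v w} → v ≈m w → Φ j v ≗ Φ j w
  Φ-congm j v≈w r = cong (λ P → lincomb P (powers j) r) (rem-cong m v≈w)

  Φ-e0 : ∀ j → Φ j e0 ≗ powers j 0
  Φ-e0 j r = begin
    1ℚ *ℚ powers j 0 r +ℚ lincomb (rem m' 0V) (λ k → powers j (suc k)) r
      ≡⟨ cong (1ℚ *ℚ powers j 0 r +ℚ_) (lincomb-vanish (rem m' 0V) (λ k → powers j (suc k)) r (λ k → inj₁ (coeff-rem-0V m' k))) ⟩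
    1ℚ *ℚ powers j 0 r +ℚ 0ℚ
      ≡⟨ solve 1 (λ u → con 1ℚ :* u :+ con 0ℚ := u) refl (powers j 0 r) ⟩
    powers j 0 r
      ∎

  Φ-S : ∀ j → powers j m ≈m c ·V e0 → ∀ v → Φ j (S v) ≈m S^ j (Φ j v)
  Φ-S j x^jm≈c v x x<m = begin
    c *ℚ v m' *ℚ powers j 0 x +ℚ A
      ≡⟨ cong (λ z → c *ℚ v m' *ℚ z +ℚ A) (cong (λ n → xres n x) (ℕP.*-zeroʳ j)) ⟩
    c *ℚ v m' *ℚ e0 x +ℚ A
      ≡⟨ solve 4 (λ c v e a → c :* v :* e :+ a := a :+ v :* (c :* e)) refl c (v m') (e0 x) A ⟩
    A +ℚ v m' *ℚ (c *ℚ e0 x)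
      ≡⟨ cong (λ z → A +ℚ v m' *ℚ z) (sym (x^jm≈c x x<m)) ⟩
    A +ℚ v m' *ℚ powers j m x
      ≡⟨ sym (lincomb-rem-suc m' v (λ r → powers j (suc r)) x) ⟩
    lincomb (rem m v) (λ r → powers j (suc r)) x
      ≡⟨ lincomb-cong (rem m v) (λ r → powers j (suc r)) (λ r → S^ j (powers j r)) x (λ r → cong (λ u → u x) (sym (powers-suc j r))) ⟩
    lincomb (rem m v) (λ r → S^ j (powers j r)) x
      ≡⟨ sym (lincomb-linear (S^-linear j) (rem m v) (powers j) x) ⟩
    S^ j (Φ j v) x
      ∎
    where
    A : ℚ
    A = lincomb (rem m' v) (λ r → powers j (suc r)) x

  Φ-xres : ∀ j → powers j m ≈m c ·V e0 → ∀ n → Φ j (xres n) ≈m powers j n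
  Φ-xres j x^jm≈c zero    x _   = Φ-e0 j x
  Φ-xres j x^jm≈c (suc n) x x<m = begin
    Φ j (S (xres n)) x           ≡⟨ Φ-S j x^jm≈c (xres n) x x<m ⟩
    S^ j (Φ j (xres n)) x        ≡⟨ S^-congm j (Φ-xres j x^jm≈c n) x x<m ⟩
    S^ j (powers j n) x          ≡⟨ cong (λ u → u x) (powers-suc j n) ⟩
    powers j (suc n) x           ∎

  module _ {A : Set} (xs : List A) (α : A → ℚ) (β : A → ℕ) where

    Nres : ℕ → V
    Nres k = sumV xs (λ i → α i ·V xres (k *ℕ β i))

    Nres-vanishes : red (ΣP xs (λ i → α i ·P xpow (β i))) ≈m 0V → ∀ k → c ^ k ≡ c → Nres k ≈m 0V
    Nres-vanishes N≈0 k c^k≡c x x<m = begin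
      Nres k x                                        ≡⟨ sumV-cong xs x (λ i → cong (α i *ℚ_) (sym (Φ-xres k x^km≈c (β i) x x<m))) ⟩
      sumV xs (λ i → α i ·V Φ k (xres (β i))) x   ≡⟨ sym (sumV-linear (Φ-linear k) xs α (λ i → xres (β i)) x) ⟩
      Φ k (sumV xs (λ i → α i ·V xres (β i))) x   ≡⟨ Φ-congm k N≈0′ x ⟩
      Φ k 0V x                                     ≡⟨ L-0 (Φ-linear k) x ⟩
      0ℚ                                           ∎
      where
      x^km≈c : powers k m ≈m c ·V e0
      x^km≈c r r<m = trans (S^-power k e0 r r<m) (cong (_*ℚ e0 r) c^k≡c)
      N≈0′ : sumV xs (λ i → α i ·V xres (β i)) ≈m 0V
      N≈0′ r r<m = trans (sumV-cong xs r (λ i → cong (α i *ℚ_) (sym (red-xpow (β i) r))))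
                         (trans (sym (lincomb-ΣP xs α (λ i → xpow (β i)) xres r)) (N≈0 r r<m))

    substitution-divides : g ∣P ΣP xs (λ i → α i ·P xpow (β i)) →
      ∀ p → (∀ k → coeffQ p k ≡ 0ℚ ⊎ c ^ k ≡ c) → g ∣P ΣP xs (λ i → α i ·P compPow p (β i))
    substitution-divides g∣N p exponents = red≈0⇒divides (ΣP xs (λ i → α i ·P compPow p (β i))) λ x x<m → begin
      red (ΣP xs (λ i → α i ·P compPow p (β i))) x
        ≡⟨ lincomb-ΣP xs α (λ i → compPow p (β i)) xres x ⟩
      sumV xs (λ i → α i ·V red (compPow p (β i))) x
        ≡⟨ sumV-cong xs x (λ i → cong (α i *ℚ_) (red-compPow p (β i) x)) ⟩
      sumV xs (λ i → α i ·V lincomb p (λ k → xres (k *ℕ β i))) x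
        ≡⟨ sumV-cong xs x (λ i → lincomb-linear (scale-linear (α i)) p _ x) ⟩
      sumV xs (λ i → lincomb p (λ k → α i ·V xres (k *ℕ β i))) x
        ≡⟨ sumV-lincomb xs p _ x ⟩
      lincomb p Nres x
        ≡⟨ lincomb-vanish p Nres x (λ k → map₂ (λ c^k≡c → Nres-vanishes N≈0 k c^k≡c x x<m) (exponents k)) ⟩
      0ℚ ∎
      where
      N≈0 : red (ΣP xs (λ i → α i ·P xpow (β i))) ≈m 0V
      N≈0 = divides⇒red≈0 (ΣP xs (λ i → α i ·P xpow (β i))) g∣N

-- Specialisation to the Möbius divisor sums

coeff-toQ-zero : ∀ f j → coeffZ f j ≡ + 0 → coeffQ (toQ f) j ≡ 0ℚ
coeff-toQ-zero []      j       _   = refl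
coeff-toQ-zero (z ∷ f) zero    z≡0 = cong (ℚ._/ 1) z≡0
coeff-toQ-zero (z ∷ f) (suc j) fj≡0 = coeff-toQ-zero f j fj≡0

mobiusSum-divisible : ∀ m' c k (f : PolyZ) → (∀ j → coeffZ f j ≡ + 0 ⊎ c ^ j ≡ c) →
  Quotient.g m' c ∣P necklace (suc k) → Quotient.g m' c ∣P mobiusSum (suc k) f
mobiusSum-divisible m' c k f exponents g∣M =
  substitution-divides divisors α β g∣N (toQ f) (λ j → map₁ (coeff-toQ-zero f j) (exponents j))
  where
  open Quotient m' c
  divisors : List ℕ
  divisors = filter (λ i → suc i ∣? suc k) (upTo (suc k))
  α : ℕ → ℚ
  α i = μ (suc i) ℚ./ 1
  β : ℕ → ℕ
  β i = suc k ℕ./ suc i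
  1/d≢0 : ℚ.NonZero (+ 1 ℚ./ suc k)
  1/d≢0 = ℚP.pos⇒nonZero (+ 1 ℚ./ suc k) {{ℚP.normalize-pos 1 (suc k)}}
  -- M_d = (1/d) N with N = Σ_{e∣d} μ(e) x^{d/e}, so g ∣ N
  g∣N : g ∣P ΣP divisors (λ i → α i ·P xpow (β i))
  g∣N = ∣P-cancel (+ 1 ℚ./ suc k) {{1/d≢0}} (ΣP divisors (λ i → α i ·P xpow (β i))) g∣M

1^ : ∀ j → 1ℚ ^ j ≡ 1ℚ
1^ zero    = refl
1^ (suc j) = trans (ℚP.*-identityˡ _) (1^ j)

even⊎odd-power : ∀ j → (Σ ℕ λ n → j ≡ 2 *ℕ n) ⊎ (-ℚ 1ℚ) ^ j ≡ -ℚ 1ℚ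
even⊎odd-power zero          = inj₁ (0 , refl)
even⊎odd-power (suc zero)    = inj₂ refl
even⊎odd-power (suc (suc j)) with even⊎odd-power j
... | inj₁ (n , j≡2n)   = inj₁ (suc n , trans (cong (λ i → suc (suc i)) j≡2n) (sym (ℕP.*-suc 2 n)))
... | inj₂ sign≡-1    = inj₂ (cong (λ q → -ℚ 1ℚ *ℚ (-ℚ 1ℚ *ℚ q)) sign≡-1)

theorem2p6 : (m d : ℕ) → 1 ≤ m → 1 ≤ d → (f : PolyZ) →
    ((xpow m -P oneP) ∣P necklace d → (xpow m -P oneP) ∣P mobiusSum d f)
    × ((xpow m +P oneP) ∣P necklace d → OddPoly f → (xpow m +P oneP) ∣P mobiusSum d f)
theorem2p6 (suc m') (suc k) (s≤s z≤n) (s≤s z≤n) f =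
    mobiusSum-divisible m' 1ℚ k f (λ j → inj₂ (1^ j))
  , λ g∣M odd → mobiusSum-divisible m' (-ℚ 1ℚ) k f (odd-exponents odd) g∣M
  where
  odd-exponents : OddPoly f → ∀ j → coeffZ f j ≡ + 0 ⊎ (-ℚ 1ℚ) ^ j ≡ -ℚ 1ℚ
  odd-exponents odd j = map₁ (λ { (n , j≡2n) → subst (λ i → coeffZ f i ≡ + 0) (sym j≡2n) (odd n) })
                             (even⊎odd-power j)
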